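{- Let $M$ be a loopless rank-$4$ matroid that is hypermodular but not modular, with closure operator $X\mapsto\overline{X}$. Let $F$ and $L$ be disjoint flats of $M$ of rank $3$ and $2$ respectively, and let $A_1,\dots,A_n$ be all the rank-$3$ flats of $M$ containing $L$. Put $T_i=A_i\cap F$ for $i\in[n]$, $T_0=L$, and $\mathcal{T}=\{T_0,\dots,T_n\}$. For a flat $J$, let $(J\vee\mathcal{T})^{(3)}=\{\overline{J\cup T}: T\in\mathcal{T},\ r(J\cup T)=3\}$. Let $\mathcal{J}$ be the collection of rank-$2$ flats $J\subseteq E(M)-(F\sqcup L)$ with $|(J\vee\mathcal{T})^{(3)}|\ge2$, let $\mathcal{J}_+=\mathcal{J}\cup\mathcal{T}$, and let $\mathcal{J}^\sharp$ be the collection of rank-$3$ flats of $M$ containing some $T\in\mathcal{T}$. Then $$\mathcal{J}^\sharp\subseteq\{\overline{J\cup J'}: J,J'\in\mathcal{J}_+,\ J\neq J'\}.$$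
   Context: A pair of flats $\{A,B\}$ is modular if $r(A\cup B)+r(A\cap B)=r(A)+r(B)$; a matroid is modular if every pair of flats is modular. A rank-$4$ matroid is hypermodular if every pair of two rank-$3$ flats is a modular pair. $[n]=\{1,\dots,n\}$. -}

module Defs where

open import Data.Nat using (ℕ; _≤_; _<_; _+_; _≟_)
open import Data.Fin using (Fin)
open import Data.Fin.Subset using (Subset; _∈_; _∉_; _⊆_; _∪_; _∩_; ⁅_⁆; ∣_∣; ⊤; Empty)
open import Data.Vec using (tabulate)
open import Data.Product using (Σ; _×_; ∃)
open import Data.Sum using (_⊎_)
open import Relation.Nullary using (¬_)
open import Relation.Nullary.Decidable using (isYes)
open import Relation.Binary.PropositionalEquality using (_≡_; _≢_)

record Matroid (m : ℕ) : Set where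
  field
    r       : Subset m → ℕ
    r-card  : ∀ X → r X ≤ ∣ X ∣
    r-mono  : ∀ X Y → X ⊆ Y → r X ≤ r Y
    r-submod : ∀ X Y → r (X ∪ Y) + r (X ∩ Y) ≤ r X + r Y

module _ {m : ℕ} (M : Matroid m) where
  open Matroid M

  cl : Subset m → Subset m
  cl X = tabulate (λ e → isYes (r (X ∪ ⁅ e ⁆) ≟ r X))

  IsFlat : Subset m → Set
  IsFlat X = cl X ≡ X

  Loopless : Set
  Loopless = ∀ (e : Fin m) → r ⁅ e ⁆ ≡ 1

  HasRank : ℕ → Set
  HasRank k = r ⊤ ≡ k

  ModularPair : Subset m → Subset m → Set
  ModularPair A B = r (A ∪ B) + r (A ∩ B) ≡ r A + r B

  IsModular : Set
  IsModular = ∀ A B → IsFlat A → IsFlat B → ModularPair A B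

  -- every pair of rank-3 flats is a modular pair (used for rank-4 matroids)
  IsHypermodular : Set
  IsHypermodular = ∀ A B → IsFlat A → IsFlat B → r A ≡ 3 → r B ≡ 3 → ModularPair A B

  module Setup (F L : Subset m) where

    InT : Subset m → Set
    InT T = T ≡ L ⊎ Σ (Subset m) (λ A → IsFlat A × r A ≡ 3 × L ⊆ A × T ≡ A ∩ F)

    -- |(J ∨ 𝒯)^(3)| ≥ 2 : the set { cl (J ∪ T) : T ∈ 𝒯, r (J ∪ T) = 3 }
    -- has two distinct elements
    JoinT3AtLeast2 : Subset m → Set
    JoinT3AtLeast2 J =
      Σ (Subset m) λ T → Σ (Subset m) λ T' →
        InT T × InT T' × r (J ∪ T) ≡ 3 × r (J ∪ T') ≡ 3 × cl (J ∪ T) ≢ cl (J ∪ T')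

    InJ : Subset m → Set
    InJ J = IsFlat J × r J ≡ 2 × Empty (J ∩ (F ∪ L)) × JoinT3AtLeast2 J

    InJ+ : Subset m → Set
    InJ+ J = InJ J ⊎ InT J

    InJsharp : Subset m → Set
    InJsharp X = IsFlat X × r X ≡ 3 × Σ (Subset m) (λ T → InT T × T ⊆ X)

-- Let X be a plane through some T ∈ 𝒯. If L ⊆ X, it is spanned by L and X ∩ F. Otherwise
-- T = A ∩ F for a plane A through L, and some f ∈ F lies off A; let B be the plane spanned
-- by L and f. If F ⊆ X, then X is spanned by A ∩ F and B ∩ F. If not, X meets F and A in
-- the line A ∩ F, and B meets A in L, so the line B ∩ X avoids F ∪ L; its joins with A ∩ F
-- and with L are X and B, so it belongs to 𝒥, and X is spanned by it and A ∩ F.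
-- Hypermodularity in rank 4 is what makes all these intersections lines.
module Submission where

open import Defs
open import Data.Nat using (ℕ; suc; _+_; _≤_; _<_; z<s)
open import Data.Nat.Properties
  using (≤-antisym; ≤-trans; ≤∧≢⇒<; <-≤-trans; m≤m+n; +-mono-≤; +-monoʳ-≤; +-comm; +-cancelˡ-≡; +-cancelʳ-≤; module ≤-Reasoning)
open import Data.Fin using (Fin)
open import Data.Fin.Subset using (Subset; _∪_; _∩_; Empty; Nonempty; _∈_; _∉_; _⊆_; ⁅_⁆; ⊥)
open import Data.Fin.Subset.Properties
  using (_∈?_; _⊆?_; ⊆-antisym; ⊆-refl; ⊆-reflexive; ⊆-trans; ⊆⊤; p⊆p∪q; q⊆p∪q; x∈p∪q⁻; x∈p∪q⁺; p∩q⊆p; p∩q⊆q;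
         x∈p∩q⁺; x∈p∩q⁻; x∈⁅x⁆; x∈⁅y⁆⇒x≡y; ∣⁅x⁆∣≡1; nonempty?; Empty-unique; ∣⊥∣≡0)
open import Data.Fin.Properties using (¬∀⟶∃¬)
open import Data.Vec.Properties using (lookup∘tabulate; []=⇒lookup; lookup⇒[]=)
open import Data.Bool.Properties using (T-≡)
open import Data.List using (List; []; _∷_; foldr; filter; allFin)
open import Data.List.Relation.Unary.All using (All; []; _∷_)
open import Data.List.Relation.Unary.All.Properties using (all-filter)
open import Data.List.Relation.Unary.Any using (here; there)
import Data.List.Membership.Propositional as List
open import Data.List.Membership.Propositional.Properties using (∈-filter⁺; ∈-allFin)
open import Data.Product using (Σ; _×_; _,_; proj₁; proj₂; ∃)
open import Data.Sum using (_⊎_; inj₁; inj₂; [_,_]′)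
open import Data.Empty using (⊥-elim)
open import Function.Bundles using (Equivalence)
open import Relation.Nullary using (¬_; yes; no)
open import Relation.Nullary.Decidable using (toWitness; fromWitness; _→-dec_)
open import Relation.Binary.PropositionalEquality using (module ≡-Reasoning; _≡_; _≢_; refl; sym; trans; cong; cong₂; subst)

module _ {n : ℕ} where

  ∪-⊆ : {P Q R : Subset n} → P ⊆ R → Q ⊆ R → P ∪ Q ⊆ R
  ∪-⊆ {P} {Q} P⊆R Q⊆R x∈ = [ P⊆R , Q⊆R ]′ (x∈p∪q⁻ P Q x∈)

  ⁅⁆-⊆ : {x : Fin n} {P : Subset n} → x ∈ P → ⁅ x ⁆ ⊆ P
  ⁅⁆-⊆ {x} {P} x∈P y∈ = subst (_∈ P) (sym (x∈⁅y⁆⇒x≡y x y∈)) x∈P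

  ⊆-or-∃∉ : (P Q : Subset n) → P ⊆ Q ⊎ ∃ λ x → x ∈ P × x ∉ Q
  ⊆-or-∃∉ P Q with P ⊆? Q
  ... | yes P⊆Q = inj₁ P⊆Q
  ... | no P⊈Q with ¬∀⟶∃¬ n (λ x → x ∈ P → x ∈ Q) (λ x → (x ∈? P) →-dec (x ∈? Q)) (λ f → P⊈Q (f _))
  ...   | x , ¬x∈P⇒x∈Q with x ∈? P
  ...     | yes x∈P = inj₂ (x , x∈P , λ x∈Q → ¬x∈P⇒x∈Q (λ _ → x∈Q))
  ...     | no x∉P = ⊥-elim (¬x∈P⇒x∈Q (λ x∈P → ⊥-elim (x∉P x∈P)))

  nonempty-disjoint⇒≢ : {P Q R : Subset n} → Nonempty P → Empty (P ∩ Q) → R ⊆ Q → P ≢ R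
  nonempty-disjoint⇒≢ (x , x∈P) P∩Q=∅ R⊆Q refl = P∩Q=∅ (x , x∈p∩q⁺ (x∈P , R⊆Q x∈P))

  insertAll : Subset n → List (Fin n) → Subset n
  insertAll = foldr (λ x Z → Z ∪ ⁅ x ⁆)

  ⊆-insertAll : (Y : Subset n) (xs : List (Fin n)) → Y ⊆ insertAll Y xs
  ⊆-insertAll Y []       = ⊆-refl
  ⊆-insertAll Y (x ∷ xs) = ⊆-trans (⊆-insertAll Y xs) (p⊆p∪q _)

  ∈-insertAll : (Y : Subset n) {x : Fin n} (xs : List (Fin n)) → x List.∈ xs → x ∈ insertAll Y xs
  ∈-insertAll Y (x ∷ xs) (here refl) = q⊆p∪q _ _ (x∈⁅x⁆ x)
  ∈-insertAll Y (x ∷ xs) (there x∈) = p⊆p∪q _ (∈-insertAll Y xs x∈)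

module MatroidProperties {m : ℕ} (M : Matroid m) where
  open Matroid M

  ∈-cl⁻ : ∀ {Y e} → e ∈ cl M Y → r (Y ∪ ⁅ e ⁆) ≡ r Y
  ∈-cl⁻ {Y} {e} e∈ =
    toWitness (Equivalence.from T-≡ (trans (sym (lookup∘tabulate _ e)) ([]=⇒lookup e∈)))

  ∈-cl⁺ : ∀ {Y e} → r (Y ∪ ⁅ e ⁆) ≡ r Y → e ∈ cl M Y
  ∈-cl⁺ {Y} {e} eq = lookup⇒[]= e _ (trans (lookup∘tabulate _ e) (Equivalence.to T-≡ (fromWitness eq)))

  r-∪-⁅∈⁆ : ∀ {Y e} → e ∈ Y → r (Y ∪ ⁅ e ⁆) ≡ r Y
  r-∪-⁅∈⁆ e∈Y = ≤-antisym (r-mono _ _ (∪-⊆ ⊆-refl (⁅⁆-⊆ e∈Y))) (r-mono _ _ (p⊆p∪q _))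

  ⊆-cl : ∀ {Y} → Y ⊆ cl M Y
  ⊆-cl e∈ = ∈-cl⁺ (r-∪-⁅∈⁆ e∈)

  -- Submodularity applied to X and Y ∪ ⁅ e ⁆.
  spanned-mono : ∀ {X Y e} → Y ⊆ X → r (Y ∪ ⁅ e ⁆) ≡ r Y → r (X ∪ ⁅ e ⁆) ≡ r X
  spanned-mono {X} {Y} {e} Y⊆X eq = ≤-antisym (+-cancelʳ-≤ (r Y) _ _ bound) (r-mono _ _ (p⊆p∪q _))
    where
      open ≤-Reasoning
      bound : r (X ∪ ⁅ e ⁆) + r Y ≤ r X + r Y
      bound = begin
        r (X ∪ ⁅ e ⁆) + r Y
          ≤⟨ +-mono-≤ (r-mono _ _ (∪-⊆ (p⊆p∪q _) (⊆-trans (q⊆p∪q Y _) (q⊆p∪q X _))))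
                       (r-mono _ _ (λ x∈ → x∈p∩q⁺ (Y⊆X x∈ , p⊆p∪q _ x∈))) ⟩
        r (X ∪ (Y ∪ ⁅ e ⁆)) + r (X ∩ (Y ∪ ⁅ e ⁆))
          ≤⟨ r-submod X (Y ∪ ⁅ e ⁆) ⟩
        r X + r (Y ∪ ⁅ e ⁆)
          ≡⟨ cong (r X +_) eq ⟩
        r X + r Y ∎

  spanned-of-equal-rank : ∀ {X Y e} → Y ⊆ X → r Y ≡ r X → r (X ∪ ⁅ e ⁆) ≡ r X → r (Y ∪ ⁅ e ⁆) ≡ r Y
  spanned-of-equal-rank {X} {Y} {e} Y⊆X rY≡rX eq = ≤-antisym
    (subst (r (Y ∪ ⁅ e ⁆) ≤_) (trans eq (sym rY≡rX)) (r-mono _ _ (∪-⊆ (⊆-trans Y⊆X (p⊆p∪q _)) (q⊆p∪q X _))))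
    (r-mono _ _ (p⊆p∪q _))

  ⊆∧r≡⇒cl≡ : ∀ {Y Z} → Y ⊆ Z → r Y ≡ r Z → cl M Y ≡ cl M Z
  ⊆∧r≡⇒cl≡ Y⊆Z rY≡rZ = ⊆-antisym (λ e∈ → ∈-cl⁺ (spanned-mono Y⊆Z (∈-cl⁻ e∈)))
                                  (λ e∈ → ∈-cl⁺ (spanned-of-equal-rank Y⊆Z rY≡rZ (∈-cl⁻ e∈)))

  cl≡flat : ∀ {Y X} → Y ⊆ X → r Y ≡ r X → IsFlat M X → cl M Y ≡ X
  cl≡flat Y⊆X rY≡rX flatX = trans (⊆∧r≡⇒cl≡ Y⊆X rY≡rX) flatX

  flat-⊆∧r≡⇒≡ : ∀ {P Q} → IsFlat M P → IsFlat M Q → P ⊆ Q → r P ≡ r Q → P ≡ Q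
  flat-⊆∧r≡⇒≡ flatP flatQ P⊆Q rP≡rQ = trans (sym flatP) (cl≡flat P⊆Q rP≡rQ flatQ)

  flat-∈ : ∀ {P e} → IsFlat M P → r (P ∪ ⁅ e ⁆) ≡ r P → e ∈ P
  flat-∈ {P} {e} flatP eq = subst (e ∈_) flatP (∈-cl⁺ eq)

  flat-∉⇒r< : ∀ {P e} → IsFlat M P → e ∉ P → r P < r (P ∪ ⁅ e ⁆)
  flat-∉⇒r< flatP e∉P = ≤∧≢⇒< (r-mono _ _ (p⊆p∪q _)) (λ eq → e∉P (flat-∈ flatP (sym eq)))

  flat-∪-⁅∉⁆ : ∀ {P e} → IsFlat M P → e ∉ P → r (P ∪ ⁅ e ⁆) ≡ suc (r P)
  flat-∪-⁅∉⁆ {P} {e} flatP e∉P = ≤-antisym upper (flat-∉⇒r< flatP e∉P)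
    where
      open ≤-Reasoning
      upper : r (P ∪ ⁅ e ⁆) ≤ suc (r P)
      upper = begin
        r (P ∪ ⁅ e ⁆)                   ≤⟨ m≤m+n _ _ ⟩
        r (P ∪ ⁅ e ⁆) + r (P ∩ ⁅ e ⁆)   ≤⟨ r-submod P ⁅ e ⁆ ⟩
        r P + r ⁅ e ⁆                   ≤⟨ +-monoʳ-≤ (r P) (subst (r ⁅ e ⁆ ≤_) (∣⁅x⁆∣≡1 e) (r-card _)) ⟩
        r P + 1                         ≡⟨ +-comm (r P) 1 ⟩
        suc (r P)                       ∎

  ∩-flat : ∀ {A B} → IsFlat M A → IsFlat M B → IsFlat M (A ∩ B)
  ∩-flat {A} {B} flatA flatB = ⊆-antisym
    (λ e∈ → x∈p∩q⁺ (flat-∈ flatA (spanned-mono (p∩q⊆p A B) (∈-cl⁻ e∈)) ,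
                    flat-∈ flatB (spanned-mono (p∩q⊆q A B) (∈-cl⁻ e∈))))
    ⊆-cl

  r-insertAll : ∀ {Y} xs → All (_∈ cl M Y) xs → r (insertAll Y xs) ≡ r Y
  r-insertAll         []       []         = refl
  r-insertAll {Y} (x ∷ xs) (x∈ ∷ xs∈) =
    trans (spanned-mono (⊆-insertAll Y xs) (∈-cl⁻ x∈)) (r-insertAll xs xs∈)

  r-cl : ∀ {Y} → r (cl M Y) ≡ r Y
  r-cl {Y} = ≤-antisym
    (subst (r (cl M Y) ≤_) (r-insertAll clY (all-filter (_∈? cl M Y) (allFin m)))
           (r-mono _ _ (λ {e} e∈ → ∈-insertAll Y clY (∈-filter⁺ (_∈? cl M Y) (∈-allFin e) e∈))))
    (r-mono _ _ ⊆-cl)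
    where clY = filter (_∈? cl M Y) (allFin m)

  cl-flat : ∀ {Y} → IsFlat M (cl M Y)
  cl-flat = sym (⊆∧r≡⇒cl≡ ⊆-cl (sym r-cl))

  r>0⇒nonempty : ∀ {P} → 0 < r P → Nonempty P
  r>0⇒nonempty {P} 0<rP with nonempty? P
  ... | yes P≠∅ = P≠∅
  ... | no P=∅ with () ← ≤-trans 0<rP (subst (λ Q → r Q ≤ 0) (sym (Empty-unique P=∅))
                                          (subst (r ⊥ ≤_) (∣⊥∣≡0 m) (r-card ⊥)))

  distinct-flats-span : ∀ {k J J' X} → IsFlat M J → IsFlat M J' → r J ≡ k → r J' ≡ k → J ≢ J' →
    IsFlat M X → r X ≡ suc k → J ⊆ X → J' ⊆ X → r (J ∪ J') ≡ suc k × X ≡ cl M (J ∪ J')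
  distinct-flats-span {k} {J} {J'} {X} flatJ flatJ' rJ rJ' J≢J' flatX rX J⊆X J'⊆X =
    r∪≡ , sym (cl≡flat (∪-⊆ J⊆X J'⊆X) (trans r∪≡ (sym rX)) flatX)
    where
      r∪≢k : r (J ∪ J') ≢ k
      r∪≢k r∪≡k = J≢J' (trans (sym flatJ) (trans (⊆∧r≡⇒cl≡ (p⊆p∪q J') (trans rJ (sym r∪≡k)))
                         (trans (sym (⊆∧r≡⇒cl≡ (q⊆p∪q J J') (trans rJ' (sym r∪≡k)))) flatJ')))
      r∪≡ : r (J ∪ J') ≡ suc k
      r∪≡ = ≤-antisym (subst (r (J ∪ J') ≤_) rX (r-mono _ _ (∪-⊆ J⊆X J'⊆X)))
                      (≤∧≢⇒< (subst (_≤ r (J ∪ J')) rJ (r-mono _ _ (p⊆p∪q J'))) (λ eq → r∪≢k (sym eq)))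

module RankFourHypermodular {m : ℕ} (M : Matroid m) (rank4 : HasRank M 4) (hyp : IsHypermodular M) where
  open Matroid M
  open MatroidProperties M

  -- Two distinct planes span the whole matroid, so modularity gives r (A ∩ B) = 3 + 3 − 4.
  r-∩-planes : ∀ {A B e} → IsFlat M A → IsFlat M B → r A ≡ 3 → r B ≡ 3 → e ∈ A → e ∉ B → r (A ∩ B) ≡ 2
  r-∩-planes {A} {B} {e} flatA flatB rA rB e∈A e∉B = +-cancelˡ-≡ 4 (r (A ∩ B)) 2 (begin
      4 + r (A ∩ B)          ≡⟨ cong (_+ r (A ∩ B)) (sym r∪≡4) ⟩
      r (A ∪ B) + r (A ∩ B)  ≡⟨ hyp A B flatA flatB rA rB ⟩
      r A + r B              ≡⟨ cong₂ _+_ rA rB ⟩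
      6                      ∎)
    where
      open ≡-Reasoning
      r∪≡4 : r (A ∪ B) ≡ 4
      r∪≡4 = ≤-antisym (subst (r (A ∪ B) ≤_) rank4 (r-mono _ _ ⊆⊤))
        (<-≤-trans (subst (_< r (B ∪ ⁅ e ⁆)) rB (flat-∉⇒r< flatB e∉B))
                   (r-mono _ _ (∪-⊆ (q⊆p∪q A B) (⁅⁆-⊆ (p⊆p∪q B e∈A)))))

  line≡∩-planes : ∀ {K A B e} → IsFlat M K → r K ≡ 2 → IsFlat M A → IsFlat M B → r A ≡ 3 → r B ≡ 3 →
    e ∈ A → e ∉ B → K ⊆ A → K ⊆ B → K ≡ A ∩ B
  line≡∩-planes flatK rK flatA flatB rA rB e∈A e∉B K⊆A K⊆B =
    flat-⊆∧r≡⇒≡ flatK (∩-flat flatA flatB) (λ x∈ → x∈p∩q⁺ (K⊆A x∈ , K⊆B x∈))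
                (trans rK (sym (r-∩-planes flatA flatB rA rB e∈A e∉B)))

module Lemma4p2 {m : ℕ} (M : Matroid m) (rank4 : HasRank M 4) (hyp : IsHypermodular M)
  (F L : Subset m) (flatF : IsFlat M F) (flatL : IsFlat M L)
  (rF : Matroid.r M F ≡ 3) (rL : Matroid.r M L ≡ 2) (F∩L=∅ : Empty (F ∩ L)) where
  open Matroid M
  open MatroidProperties M
  open RankFourHypermodular M rank4 hyp
  open Setup M F L

  SpannedByTwo : Subset m → Set
  SpannedByTwo X = Σ (Subset m) λ J → Σ (Subset m) λ J' → InJ+ J × InJ+ J' × J ≢ J' × X ≡ cl M (J ∪ J')

  ∈L⇒∉F : ∀ {x} → x ∈ L → x ∉ F
  ∈L⇒∉F x∈L x∈F = F∩L=∅ (_ , x∈p∩q⁺ (x∈F , x∈L))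

  L-nonempty : Nonempty L
  L-nonempty = r>0⇒nonempty (subst (0 <_) (sym rL) z<s)

  r-plane∩F : ∀ {A} → IsFlat M A → r A ≡ 3 → L ⊆ A → r (A ∩ F) ≡ 2
  r-plane∩F flatA rA L⊆A with l , l∈L ← L-nonempty = r-∩-planes flatA flatF rA rF (L⊆A l∈L) (∈L⇒∉F l∈L)

  L∨⁅_⁆ : Fin m → Subset m
  L∨⁅ f ⁆ = cl M (L ∪ ⁅ f ⁆)

  spanned-if-L⊆X : ∀ {X} → IsFlat M X → r X ≡ 3 → L ⊆ X → SpannedByTwo X
  spanned-if-L⊆X {X} flatX rX L⊆X =
    L , X ∩ F , inj₂ (inj₁ refl) , inj₂ (inj₂ (X , flatX , rX , L⊆X , refl)) , L≢X∩F ,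
    proj₂ (distinct-flats-span flatL (∩-flat flatX flatF) rL (r-plane∩F flatX rX L⊆X) L≢X∩F
                               flatX rX L⊆X (p∩q⊆p X F))
    where
      L≢X∩F : L ≢ X ∩ F
      L≢X∩F L≡X∩F with l , l∈L ← L-nonempty = ∈L⇒∉F l∈L (p∩q⊆q X F (⊆-reflexive L≡X∩F l∈L))

  module NotThroughL {X A : Subset m} {l f : Fin m} (flatX : IsFlat M X) (rX : r X ≡ 3) (l∈L : l ∈ L) (l∉X : l ∉ X)
              (flatA : IsFlat M A) (rA : r A ≡ 3) (L⊆A : L ⊆ A) (f∈F : f ∈ F) (f∉A : f ∉ A) where

    T : Subset m
    T = A ∩ F

    B : Subset m
    B = L∨⁅ f ⁆

    T∈𝒯 : InT T
    T∈𝒯 = inj₂ (A , flatA , rA , L⊆A , refl)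

    flatT : IsFlat M T
    flatT = ∩-flat flatA flatF

    rT : r T ≡ 2
    rT = r-plane∩F flatA rA L⊆A

    flatB : IsFlat M B
    flatB = cl-flat

    rB : r B ≡ 3
    rB = trans r-cl (trans (flat-∪-⁅∉⁆ flatL (λ f∈L → ∈L⇒∉F f∈L f∈F)) (cong suc rL))

    L⊆B : L ⊆ B
    L⊆B = ⊆-trans (p⊆p∪q _) ⊆-cl

    f∈B : f ∈ B
    f∈B = ⊆-cl (q⊆p∪q L ⁅ f ⁆ (x∈⁅x⁆ f))

    spanned-if-F⊆X : F ⊆ X → SpannedByTwo X
    spanned-if-F⊆X F⊆X =
      T , B ∩ F , inj₂ T∈𝒯 , inj₂ (inj₂ (B , flatB , rB , L⊆B , refl)) , T≢B∩F ,
      proj₂ (distinct-flats-span flatT (∩-flat flatB flatF) rT (r-plane∩F flatB rB L⊆B) T≢B∩F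
                                 flatX rX (⊆-trans (p∩q⊆q A F) F⊆X) (⊆-trans (p∩q⊆q B F) F⊆X))
      where
        T≢B∩F : T ≢ B ∩ F
        T≢B∩F T≡B∩F = f∉A (p∩q⊆p A F (⊆-reflexive (sym T≡B∩F) (x∈p∩q⁺ (f∈B , f∈F))))

    spanned-if-F⊈X : ∀ {g} → g ∈ F → g ∉ X → T ⊆ X → SpannedByTwo X
    spanned-if-F⊈X {g} g∈F g∉X T⊆X = J , T , inj₁ J∈𝒥 , inj₂ T∈𝒯 , J≢T , proj₂ J∨T
      where
        J : Subset m
        J = B ∩ X
        flatJ : IsFlat M J
        flatJ = ∩-flat flatB flatX
        rJ : r J ≡ 2
        rJ = r-∩-planes flatB flatX rB rX (L⊆B l∈L) l∉X
        T≡F∩X : T ≡ F ∩ X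
        T≡F∩X = line≡∩-planes flatT rT flatF flatX rF rX g∈F g∉X (p∩q⊆q A F) T⊆X
        T≡A∩X : T ≡ A ∩ X
        T≡A∩X = line≡∩-planes flatT rT flatA flatX rA rX (L⊆A l∈L) l∉X (p∩q⊆p A F) T⊆X
        L≡B∩A : L ≡ B ∩ A
        L≡B∩A = line≡∩-planes flatL rL flatB flatA rB rA f∈B f∉A L⊆B L⊆A
        J∩F=∅ : ∀ {x} → x ∈ J → x ∉ F
        J∩F=∅ x∈J x∈F = ∈L⇒∉F (⊆-reflexive (sym L≡B∩A) (x∈p∩q⁺ (p∩q⊆p B X x∈J ,
                           p∩q⊆p A F (⊆-reflexive (sym T≡F∩X) (x∈p∩q⁺ (x∈F , p∩q⊆q B X x∈J)))))) x∈F
        J∩L=∅ : ∀ {x} → x ∈ J → x ∉ L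
        J∩L=∅ x∈J x∈L = ∈L⇒∉F x∈L (p∩q⊆q A F (⊆-reflexive (sym T≡A∩X) (x∈p∩q⁺ (L⊆A x∈L , p∩q⊆q B X x∈J))))
        J∩[F∪L]=∅ : Empty (J ∩ (F ∪ L))
        J∩[F∪L]=∅ (x , x∈) with x∈J , x∈F∪L ← x∈p∩q⁻ J (F ∪ L) x∈ =
          [ J∩F=∅ x∈J , J∩L=∅ x∈J ]′ (x∈p∪q⁻ F L x∈F∪L)
        J-nonempty : Nonempty J
        J-nonempty = r>0⇒nonempty (subst (0 <_) (sym rJ) z<s)
        J≢T : J ≢ T
        J≢T = nonempty-disjoint⇒≢ J-nonempty J∩[F∪L]=∅ (λ x∈T → x∈p∪q⁺ (inj₁ (p∩q⊆q A F x∈T)))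
        J≢L : J ≢ L
        J≢L = nonempty-disjoint⇒≢ J-nonempty J∩[F∪L]=∅ (λ x∈L → x∈p∪q⁺ (inj₂ x∈L))
        J∨T : r (J ∪ T) ≡ 3 × X ≡ cl M (J ∪ T)
        J∨T = distinct-flats-span flatJ flatT rJ rT J≢T flatX rX (p∩q⊆q B X) T⊆X
        J∨L : r (J ∪ L) ≡ 3 × B ≡ cl M (J ∪ L)
        J∨L = distinct-flats-span flatJ flatL rJ rL J≢L flatB rB (p∩q⊆p B X) L⊆B
        J∨T≢J∨L : cl M (J ∪ T) ≢ cl M (J ∪ L)
        J∨T≢J∨L eq = l∉X (⊆-reflexive (sym (trans (proj₂ J∨T) (trans eq (sym (proj₂ J∨L))))) (L⊆B l∈L))
        J∈𝒥 : InJ J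
        J∈𝒥 = flatJ , rJ , J∩[F∪L]=∅ , T , L , T∈𝒯 , inj₁ refl , proj₁ J∨T , proj₁ J∨L , J∨T≢J∨L

  plane-spanned : ∀ X → InJsharp X → SpannedByTwo X
  plane-spanned X (flatX , rX , T , T∈𝒯 , T⊆X) with ⊆-or-∃∉ L X
  ... | inj₁ L⊆X = spanned-if-L⊆X flatX rX L⊆X
  ... | inj₂ (l , l∈L , l∉X) with T∈𝒯
  ...   | inj₁ refl = ⊥-elim (l∉X (T⊆X l∈L))
  ...   | inj₂ (A , flatA , rA , L⊆A , refl) with ⊆-or-∃∉ F A
  ...     | inj₁ F⊆A = ⊥-elim (∈L⇒∉F l∈L (⊆-reflexive (sym F≡A) (L⊆A l∈L)))
    where
      F≡A : F ≡ A
      F≡A = flat-⊆∧r≡⇒≡ flatF flatA F⊆A (trans rF (sym rA))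
  ...     | inj₂ (f , f∈F , f∉A) with ⊆-or-∃∉ F X
  ...       | inj₁ F⊆X = NotThroughL.spanned-if-F⊆X flatX rX l∈L l∉X flatA rA L⊆A f∈F f∉A F⊆X
  ...       | inj₂ (g , g∈F , g∉X) = NotThroughL.spanned-if-F⊈X flatX rX l∈L l∉X flatA rA L⊆A f∈F f∉A g∈F g∉X T⊆X

lemma4p2 : ∀ {m : ℕ} (M : Matroid m) →
    Loopless M → HasRank M 4 → IsHypermodular M → ¬ IsModular M →
    ∀ (F L : Subset m) → IsFlat M F → IsFlat M L →
    Matroid.r M F ≡ 3 → Matroid.r M L ≡ 2 → Empty (F ∩ L) →
    ∀ (X : Subset m) → Setup.InJsharp M F L X →
    Σ (Subset m) λ J → Σ (Subset m) λ J' →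
      Setup.InJ+ M F L J × Setup.InJ+ M F L J' × J ≢ J' × X ≡ cl M (J ∪ J')
lemma4p2 M _ rank4 hyp _ = Lemma4p2.plane-spanned M rank4 hyp
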